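{- For each $n>3$ and each $k\in[2,n-2]$, $$\theta_k^{(n)}=1+\sum_{j=k-1}^{n-2}\theta_j^{(n-1)}.$$
   Context: For $n\ge1$, a non-degenerate indexing matrix (for $n$) is a $2\times m$ matrix $A=[a_{ij}]$ with $1\le m\le n$ such that: $a_{ij}\in[0,n-1]$; $a_{1j}<a_{1k}$ for $j<k$; $a_{2j}\le a_{2k}$ for $j<k$; if $a_{2j}=a_{2k}$ with $j<k$ then $a_{2j}=a_{2k}=0$; $a_{1j}\ge a_{2j}$ for all $j$. It is positive if all its entries are positive. For $n\ge2$ and $k\in[1,n-1]$, $\theta_k^{(n)}$ is the number of positive non-degenerate indexing matrices $C=[c_{ij}]$ for $n$ with $c_{11}=k$. -}

module Defs where

open import Data.Nat using (ℕ; zero; suc; _+_; _∸_; _≤_; _<_; _≤?_; _<?_; _≟_)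
open import Data.Product using (_×_; _,_; proj₁; proj₂)
open import Data.List using (List; []; _∷_; length; map; concatMap; upTo; filter)
open import Data.Nat.ListAction using (sum)
open import Data.List.Relation.Unary.All using (All; all?)
open import Data.List.Relation.Unary.AllPairs using (AllPairs; allPairs?)
open import Data.Empty using (⊥)
open import Relation.Nullary using (Dec; yes; no)
open import Relation.Nullary.Decidable using (_×-dec_; _→-dec_)
open import Relation.Binary.PropositionalEquality using (_≡_)

-- A 2 × m matrix is represented by the list of its m columns;
-- column j is the pair (a_{1j} , a_{2j}).
Column : Set
Column = ℕ × ℕ

Matrix : Set
Matrix = List Column

row1 row2 : Column → ℕ
row1 = proj₁
row2 = proj₂

EqZero : Column → Column → Set
EqZero c d = row2 c ≡ row2 d → (row2 c ≡ 0 × row2 d ≡ 0)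

IsNDIM : ℕ → Matrix → Set
IsNDIM n A =
  (1 ≤ length A × length A ≤ n) ×
  All (λ c → row1 c < n × row2 c < n) A ×
  AllPairs (λ c d → row1 c < row1 d) A ×
  AllPairs (λ c d → row2 c ≤ row2 d) A ×
  AllPairs EqZero A ×
  All (λ c → row2 c ≤ row1 c) A

IsPositive : Matrix → Set
IsPositive A = All (λ c → 0 < row1 c × 0 < row2 c) A

Entry11≡ : ℕ → Matrix → Set
Entry11≡ k []      = ⊥
Entry11≡ k (c ∷ _) = row1 c ≡ k

IsPosNDIM₁₁ : ℕ → ℕ → Matrix → Set
IsPosNDIM₁₁ n k C = IsNDIM n C × IsPositive C × Entry11≡ k C

entry11? : ∀ k A → Dec (Entry11≡ k A)
entry11? k []      = no (λ ())
entry11? k (c ∷ _) = row1 c ≟ k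

isNDIM? : ∀ n A → Dec (IsNDIM n A)
isNDIM? n A =
  ((1 ≤? length A) ×-dec (length A ≤? n)) ×-dec
  all? (λ c → (row1 c <? n) ×-dec (row2 c <? n)) A ×-dec
  allPairs? (λ c d → row1 c <? row1 d) A ×-dec
  allPairs? (λ c d → row2 c ≤? row2 d) A ×-dec
  allPairs? (λ c d → (row2 c ≟ row2 d) →-dec ((row2 c ≟ 0) ×-dec (row2 d ≟ 0))) A ×-dec
  all? (λ c → row2 c ≤? row1 c) A

isPosNDIM₁₁? : ∀ n k A → Dec (IsPosNDIM₁₁ n k A)
isPosNDIM₁₁? n k A =
  isNDIM? n A ×-dec
  all? (λ c → (0 <? row1 c) ×-dec (0 <? row2 c)) A ×-dec
  entry11? k A

listsOf : {X : Set} → List X → ℕ → List (List X)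
listsOf xs zero    = [] ∷ []
listsOf xs (suc m) = concatMap (λ x → map (x ∷_) (listsOf xs m)) xs

columns : ℕ → List Column
columns n = concatMap (λ a → map (a ,_) (upTo n)) (upTo n)

-- All 2 × m matrices with entries in [0, n-1] and 1 ≤ m ≤ n, each listed once.
candidates : ℕ → List Matrix
candidates n = concatMap (λ i → listsOf (columns n) (suc i)) (upTo n)

θ : ℕ → ℕ → ℕ
θ n k = length (filter (isPosNDIM₁₁? n k) (candidates n))

-- Σ_{j=a}^{b} f j  (empty if b < a)
sumFromTo : ℕ → ℕ → (ℕ → ℕ) → ℕ
sumFromTo a b f = sum (map (λ i → f (a + i)) (upTo (suc b ∸ a)))

-- A positive non-degenerate indexing matrix is a chain of columns (a , b) with
-- 0 < b ≤ a < n, strictly increasing in both rows (a repeated second-row entry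
-- would have to be 0). Sort the chains counted by θ_k^(n) by their first column
-- (k , b). For b ≥ 2, lowering every entry by one gives exactly the chains
-- counted by θ_(k-1)^(n-1). For b = 1 the chain is either the column (k , 1)
-- alone or continues with some (a , b') where a > k and b' ≥ 2; lowering the
-- remaining columns by one gives a chain counted by θ_(a-1)^(n-1). Hence
-- θ_k^(n) = θ_(k-1)^(n-1) + 1 + Σ_(j ≥ k) θ_j^(n-1).

module Submission where

open import Defs
open import Data.Nat using (ℕ; zero; suc; _+_; _*_; _∸_; _≤_; _<_; _≤?_; _<?_; _≟_; z≤n; s≤s; s≤s⁻¹; z<s; s<s)
open import Data.Nat.Properties
open import Algebra.Properties.CommutativeSemigroup +-commutativeSemigroup using (interchange)
open import Data.Nat.ListAction using (sum)
open import Data.Nat.ListAction.Properties using (sum-++)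
open import Data.Bool using (true; false; if_then_else_)
open import Data.Product using (_×_; _,_; proj₁; proj₂; uncurry)
open import Data.List using (List; []; _∷_; _++_; length; map; concatMap; upTo; applyUpTo; filter)
open import Data.List.Properties using (map-++; map-∘; map-cong; map-applyUpTo)
open import Data.List.Relation.Unary.All as All using (All; []; _∷_)
open import Data.List.Relation.Unary.AllPairs as AllPairs using (AllPairs; []; _∷_)
open import Data.List.Relation.Unary.Linked using (Linked; [-]; _∷_; linked?)
open import Data.List.Relation.Unary.Linked.Properties using (AllPairs⇒Linked; Linked⇒AllPairs)
open import Function using (_∘_; _$_; _⇔_; mk⇔; Equivalence)
open import Relation.Nullary using (Dec; yes; no; does; contradiction)
open import Relation.Nullary.Decidable using (_×-dec_)
open import Relation.Binary.Definitions using (Transitive; Decidable)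
open import Relation.Binary.PropositionalEquality

-- Opaque, so that unification never unfolds ∑ (suc n) f; ∑-suc exposes the recursion.
opaque
  ∑ : ℕ → (ℕ → ℕ) → ℕ
  ∑ zero    f = 0
  ∑ (suc n) f = f 0 + ∑ n (f ∘ suc)

  infix 5 ∑
  syntax ∑ n (λ i → e) = ∑[ i < n ] e

  ∑-suc : ∀ n (f : ℕ → ℕ) → ∑ (suc n) f ≡ f 0 + ∑ n (f ∘ suc)
  ∑-suc n f = refl

  ∑-cong : ∀ n {f g : ℕ → ℕ} → (∀ i → i < n → f i ≡ g i) → ∑ n f ≡ ∑ n g
  ∑-cong zero    _ = refl
  ∑-cong (suc n) h = cong₂ _+_ (h 0 z<s) (∑-cong n (λ i i<n → h (suc i) (s<s i<n)))

  ∑-zero : ∀ n {f : ℕ → ℕ} → (∀ i → i < n → f i ≡ 0) → ∑ n f ≡ 0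
  ∑-zero zero    _ = refl
  ∑-zero (suc n) h = cong₂ _+_ (h 0 z<s) (∑-zero n (λ i i<n → h (suc i) (s<s i<n)))

  ∑-+ : ∀ n (f g : ℕ → ℕ) → ∑[ i < n ] (f i + g i) ≡ ∑ n f + ∑ n g
  ∑-+ zero    f g = refl
  ∑-+ (suc n) f g = trans (cong ((f 0 + g 0) +_) (∑-+ n (f ∘ suc) (g ∘ suc)))
                          (interchange (f 0) (g 0) (∑ n (f ∘ suc)) (∑ n (g ∘ suc)))

  *-distribˡ-∑ : ∀ n c (f : ℕ → ℕ) → c * ∑ n f ≡ ∑[ i < n ] (c * f i)
  *-distribˡ-∑ zero    c f = *-zeroʳ c
  *-distribˡ-∑ (suc n) c f = trans (*-distribˡ-+ c (f 0) _) (cong (c * f 0 +_) (*-distribˡ-∑ n c (f ∘ suc)))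

  ∑-swap : ∀ m n (f : ℕ → ℕ → ℕ) → ∑[ i < m ] ∑[ j < n ] f i j ≡ ∑[ j < n ] ∑[ i < m ] f i j
  ∑-swap zero    n f = sym (∑-zero n (λ _ _ → refl))
  ∑-swap (suc m) n f = trans (cong (∑ n (f 0) +_) (∑-swap m n (f ∘ suc))) (sym (∑-+ n (f 0) _))

  ∑-last : ∀ n (f : ℕ → ℕ) → ∑ (suc n) f ≡ ∑ n f + f n
  ∑-last zero    f = +-identityʳ (f 0)
  ∑-last (suc n) f = trans (cong (f 0 +_) (∑-last n (f ∘ suc))) (sym (+-assoc (f 0) _ _))

  ∑-pick : ∀ n k (f : ℕ → ℕ) → k < n → (∀ i → i ≢ k → f i ≡ 0) → ∑ n f ≡ f k
  ∑-pick (suc n) zero    f _         h =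
    trans (cong (f 0 +_) (∑-zero n (λ i _ → h (suc i) λ ()))) (+-identityʳ (f 0))
  ∑-pick (suc n) (suc k) f (s≤s k<n) h =
    trans (cong (_+ ∑ n (f ∘ suc)) (h 0 λ ()))
          (∑-pick n k (f ∘ suc) k<n (λ i i≢k → h (suc i) (i≢k ∘ suc-injective)))

  ∑-drop : ∀ n k (f : ℕ → ℕ) → (∀ i → i < k → f i ≡ 0) → ∑ n f ≡ ∑[ i < n ∸ k ] f (k + i)
  ∑-drop n       zero    f h = refl
  ∑-drop zero    (suc k) f h = refl
  ∑-drop (suc n) (suc k) f h =
    trans (cong (_+ ∑ n (f ∘ suc)) (h 0 z<s)) (∑-drop n k (f ∘ suc) (λ i i<k → h (suc i) (s<s i<k)))

  ∑-truncate : ∀ n k (f : ℕ → ℕ) → k ≤ n → (∀ i → k ≤ i → f i ≡ 0) → ∑ n f ≡ ∑ k f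
  ∑-truncate n       zero    f _         h = ∑-zero n (λ i _ → h i z≤n)
  ∑-truncate (suc n) (suc k) f (s≤s k≤n) h =
    cong (f 0 +_) (∑-truncate n k (f ∘ suc) k≤n (λ i k≤i → h (suc i) (s≤s k≤i)))

  ∑-from-suc : ∀ m k (f : ℕ → ℕ) → k ≤ m →
               ∑[ i < suc m ∸ k ] f (k + i) ≡ f k + (∑[ i < m ∸ k ] f (suc k + i))
  ∑-from-suc m k f k≤m = begin
    ∑[ i < suc m ∸ k ] f (k + i)
      ≡⟨ cong (λ l → ∑[ i < l ] f (k + i)) (+-∸-assoc 1 k≤m) ⟩
    f (k + 0) + (∑[ i < m ∸ k ] f (k + suc i))
      ≡⟨ cong₂ _+_ (cong f (+-identityʳ k)) (∑-cong (m ∸ k) (λ i _ → cong f (+-suc k i))) ⟩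
    f k + (∑[ i < m ∸ k ] f (suc k + i)) ∎
    where open ≡-Reasoning

  ∑∑-shift : ∀ n (f : Column → ℕ) → (∀ b → f (0 , b) ≡ 0) → (∀ a → f (a , 0) ≡ 0) →
             ∑[ a < suc n ] ∑[ b < suc n ] f (a , b) ≡ ∑[ a < n ] ∑[ b < n ] f (suc a , suc b)
  ∑∑-shift n f zero-row zero-column =
    cong₂ _+_ (∑-zero (suc n) (λ b _ → zero-row b))
              (∑-cong n (λ a _ → cong (_+ ∑ n (λ b → f (suc a , suc b))) (zero-column (suc a))))

  sum-map-upTo : ∀ n (f : ℕ → ℕ) → sum (map f (upTo n)) ≡ ∑ n f
  sum-map-upTo n f = trans (cong sum (map-applyUpTo _ f n)) (sum-applyUpTo n f)
    where
    sum-applyUpTo : ∀ n (f : ℕ → ℕ) → sum (applyUpTo f n) ≡ ∑ n f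
    sum-applyUpTo zero    f = refl
    sum-applyUpTo (suc n) f = cong (f 0 +_) (sum-applyUpTo n (f ∘ suc))

private variable P Q : Set

𝟙 : Dec P → ℕ
𝟙 d = if does d then 1 else 0

𝟙-yes : (d : Dec P) → P → 𝟙 d ≡ 1
𝟙-yes (yes _) _ = refl
𝟙-yes (no ¬p) p = contradiction p ¬p

𝟙*-cong : (d : Dec P) {x y : ℕ} → (P → x ≡ y) → 𝟙 d * x ≡ 𝟙 d * y
𝟙*-cong (yes p) x≡y = cong (_+ 0) (x≡y p)
𝟙*-cong (no _)  _   = refl

𝟙*-zero : (d : Dec P) {x : ℕ} → (P → x ≡ 0) → 𝟙 d * x ≡ 0
𝟙*-zero d x≡0 = trans (𝟙*-cong d x≡0) (*-zeroʳ (𝟙 d))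

𝟙-cong : P ⇔ Q → (p : Dec P) (q : Dec Q) → 𝟙 p ≡ 𝟙 q
𝟙-cong P⇔Q (yes p) q = sym (𝟙-yes q (Equivalence.to P⇔Q p))
𝟙-cong P⇔Q (no ¬p) (yes q) = contradiction (Equivalence.from P⇔Q q) ¬p
𝟙-cong P⇔Q (no ¬p) (no _)  = refl

𝟙-× : (p : Dec P) (q : Dec Q) → 𝟙 (p ×-dec q) ≡ 𝟙 p * 𝟙 q
𝟙-× (yes _) (yes _) = refl
𝟙-× (yes _) (no _)  = refl
𝟙-× (no _)  _       = refl

module _ {A : Set} where

  length-filter≡sum-𝟙 : {P : A → Set} (P? : ∀ x → Dec (P x)) (xs : List A) →
                        length (filter P? xs) ≡ sum (map (𝟙 ∘ P?) xs)
  length-filter≡sum-𝟙 P? []       = refl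
  length-filter≡sum-𝟙 P? (x ∷ xs) with does (P? x)
  ... | true  = cong suc (length-filter≡sum-𝟙 P? xs)
  ... | false = length-filter≡sum-𝟙 P? xs

  sum-map-concatMap : {B : Set} (w : B → ℕ) (g : A → List B) (xs : List A) →
                      sum (map w (concatMap g xs)) ≡ sum (map (λ x → sum (map w (g x))) xs)
  sum-map-concatMap w g []       = refl
  sum-map-concatMap w g (x ∷ xs) = begin
    sum (map w (g x ++ concatMap g xs))
      ≡⟨ cong sum (map-++ w (g x) (concatMap g xs)) ⟩
    sum (map w (g x) ++ map w (concatMap g xs))
      ≡⟨ sum-++ (map w (g x)) _ ⟩
    sum (map w (g x)) + sum (map w (concatMap g xs))
      ≡⟨ cong (sum (map w (g x)) +_) (sum-map-concatMap w g xs) ⟩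
    sum (map w (g x)) + sum (map (λ x → sum (map w (g x))) xs) ∎
    where open ≡-Reasoning

  *-distribˡ-sum-map : ∀ c (w : A → ℕ) (xs : List A) → c * sum (map w xs) ≡ sum (map (λ x → c * w x) xs)
  *-distribˡ-sum-map c w []       = *-zeroʳ c
  *-distribˡ-sum-map c w (x ∷ xs) = trans (*-distribˡ-+ c (w x) _) (cong (c * w x +_) (*-distribˡ-sum-map c w xs))

_≺_ : Column → Column → Set
c ≺ d = row1 c < row1 d × row2 c < row2 d

≺-trans : Transitive _≺_
≺-trans (p₁ , p₂) (q₁ , q₂) = <-trans p₁ q₁ , <-trans p₂ q₂

Admissible : ℕ → Column → Set
Admissible n c = row2 c ≤ row1 c × row1 c < n

-- Positivity of d is left out: it follows from c ≺ d, and without it Step is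
-- invariant under lowering all entries by one (step-shift).
Step : ℕ → Column → Column → Set
Step n c d = c ≺ d × Admissible n d

Head : ℕ → ℕ → Column → Set
Head n k c = row1 c ≡ k × 0 < row2 c × Admissible n c

admissible? : ∀ n c → Dec (Admissible n c)
admissible? n c = (row2 c ≤? row1 c) ×-dec (row1 c <? n)

step? : ∀ n → Decidable (Step n)
step? n c d = ((row1 c <? row1 d) ×-dec (row2 c <? row2 d)) ×-dec admissible? n d

head? : ∀ n k c → Dec (Head n k c)
head? n k c = (row1 c ≟ k) ×-dec (0 <? row2 c) ×-dec admissible? n c

module _ {A : Set} {R : A → A → Set} {P : A → Set} where

  Linked-targets : ∀ {x xs} → Linked (λ y z → R y z × P z) (x ∷ xs) → Linked R (x ∷ xs) × All P xs
  Linked-targets [-]              = [-] , []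
  Linked-targets ((r , p) ∷ rest) = let rs , ps = Linked-targets rest in r ∷ rs , p ∷ ps

  Linked-with-targets : ∀ {x xs} → Linked R (x ∷ xs) → All P xs → Linked (λ y z → R y z × P z) (x ∷ xs)
  Linked-with-targets [-]       []       = [-]
  Linked-with-targets (r ∷ rs) (p ∷ ps) = (r , p) ∷ Linked-with-targets rs ps

strictly-increasing-row2 : ∀ {cs} → AllPairs (λ c d → row2 c ≤ row2 d) cs → AllPairs EqZero cs →
                           All (λ c → 0 < row2 c) cs → AllPairs (λ c d → row2 c < row2 d) cs
strictly-increasing-row2 []             []             []           = []
strictly-increasing-row2 (c≤ds ∷ ≤-rest) (c≡ds ∷ ≡-rest) (c>0 ∷ pos) =
  All.zipWith (λ (≤d , ≡d) → ≤∧≢⇒< ≤d (λ e → <-irrefl (sym (proj₁ (≡d e))) c>0)) (c≤ds , c≡ds) ∷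
  strictly-increasing-row2 ≤-rest ≡-rest pos

length-chain : ∀ {n c t} → Linked (Step n) (c ∷ t) → row1 c < n → length t + row1 c < n
length-chain             [-]                      c<n = c<n
length-chain {t = _ ∷ t} (((c<d , _) , _ , d<n) ∷ chain) _ =
  ≤-<-trans (≤-reflexive (sym (+-suc (length t) _)))
            (≤-<-trans (+-monoʳ-≤ (length t) c<d) (length-chain chain d<n))

posNDIM₁₁⇔chain : ∀ n k c t → IsPosNDIM₁₁ n k (c ∷ t) ⇔ (Head n k c × Linked (Step n) (c ∷ t))
posNDIM₁₁⇔chain n k c t = mk⇔ to from
  where
  to : IsPosNDIM₁₁ n k (c ∷ t) → Head n k c × Linked (Step n) (c ∷ t)
  to ((_ , bounds , row1< , row2≤ , eqZero , below) , positive , c₁₁≡k) =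
    (c₁₁≡k , proj₂ (All.head positive) , All.head admissible) ,
    Linked-with-targets (AllPairs⇒Linked increasing) (All.tail admissible)
    where
    admissible = All.zipWith (λ (r₂≤r₁ , r₁<n , _) → r₂≤r₁ , r₁<n) (below , bounds)
    increasing = AllPairs.zipWith (λ x → x)
                   (row1< , strictly-increasing-row2 row2≤ eqZero (All.map proj₂ positive))
  from : Head n k c × Linked (Step n) (c ∷ t) → IsPosNDIM₁₁ n k (c ∷ t)
  from ((c₁₁≡k , c₂>0 , c-admissible) , chain) =
    ((s≤s z≤n , ≤-trans (m≤m+n (suc (length t)) (row1 c)) (length-chain chain (proj₂ c-admissible))) ,
     All.map (λ (r₂≤r₁ , r₁<n) → r₁<n , ≤-<-trans r₂≤r₁ r₁<n) admissible ,
     AllPairs.map proj₁ increasing , AllPairs.map (<⇒≤ ∘ proj₂) increasing ,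
     AllPairs.map (λ (_ , r₂<r₂) e → contradiction e (<⇒≢ r₂<r₂)) increasing ,
     All.map proj₁ admissible) ,
    All.zipWith (λ (r₂>0 , r₂≤r₁ , _) → <-≤-trans r₂>0 r₂≤r₁ , r₂>0) (row2-positive , admissible) , c₁₁≡k
    where
    ≺-chain = proj₁ (Linked-targets chain)
    admissible = c-admissible ∷ proj₂ (Linked-targets chain)
    increasing = Linked⇒AllPairs ≺-trans ≺-chain
    row2-positive : All (λ d → 0 < row2 d) (c ∷ t)
    row2-positive with c≺t ∷ _ ← increasing = c₂>0 ∷ All.map (λ (_ , c₂<d₂) → <-trans c₂>0 c₂<d₂) c≺t

-- The number of t with i columns such that c ∷ t is a chain. Lengths i < n are
-- all that occur (extensions-long≡0), so chainsFrom counts all chains from c.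
extensions : ℕ → ℕ → Column → ℕ
extensions n i c = length (filter (λ t → linked? (step? n) (c ∷ t)) (listsOf (columns n) i))

sum-map-columns : ∀ n (w : Column → ℕ) → sum (map w (columns n)) ≡ ∑[ a < n ] ∑[ b < n ] w (a , b)
sum-map-columns n w = begin
  sum (map w (columns n))
    ≡⟨ sum-map-concatMap w (λ a → map (a ,_) (upTo n)) (upTo n) ⟩
  sum (map (λ a → sum (map w (map (a ,_) (upTo n)))) (upTo n))
    ≡⟨ sum-map-upTo n _ ⟩
  ∑[ a < n ] sum (map w (map (a ,_) (upTo n)))
    ≡⟨ ∑-cong n (λ a _ → cong sum (sym (map-∘ (upTo n)))) ⟩
  ∑[ a < n ] sum (map (λ b → w (a , b)) (upTo n))
    ≡⟨ ∑-cong n (λ a _ → sum-map-upTo n _) ⟩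
  ∑[ a < n ] ∑[ b < n ] w (a , b) ∎
  where open ≡-Reasoning

sum-map-listsOf-columns : ∀ n i (w : Matrix → ℕ) → sum (map w (listsOf (columns n) (suc i))) ≡
                          ∑[ a < n ] ∑[ b < n ] sum (map (λ t → w ((a , b) ∷ t)) (listsOf (columns n) i))
sum-map-listsOf-columns n i w = begin
  sum (map w (concatMap (λ c → map (c ∷_) ts) (columns n)))
    ≡⟨ sum-map-concatMap w _ (columns n) ⟩
  sum (map (λ c → sum (map w (map (c ∷_) ts))) (columns n))
    ≡⟨ cong sum (map-cong (λ c → cong sum (sym (map-∘ ts))) (columns n)) ⟩
  sum (map (λ c → sum (map (λ t → w (c ∷ t)) ts)) (columns n))
    ≡⟨ sum-map-columns n _ ⟩
  ∑[ a < n ] ∑[ b < n ] sum (map (λ t → w ((a , b) ∷ t)) ts) ∎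
  where
  open ≡-Reasoning
  ts = listsOf (columns n) i

sum-𝟙-factor : ∀ n i d {P : Matrix → Set} (P? : ∀ t → Dec (P t)) (Q? : Dec Q) →
               (∀ t → P (d ∷ t) ⇔ (Q × Linked (Step n) (d ∷ t))) →
               sum (map (λ t → 𝟙 (P? (d ∷ t))) (listsOf (columns n) i)) ≡ 𝟙 Q? * extensions n i d
sum-𝟙-factor n i d P? Q? split = begin
  sum (map (λ t → 𝟙 (P? (d ∷ t))) ts)
    ≡⟨ cong sum (map-cong (λ t → trans (𝟙-cong (split t) (P? (d ∷ t)) (Q? ×-dec linked d t)) (𝟙-× Q? (linked d t))) ts) ⟩
  sum (map (λ t → 𝟙 Q? * 𝟙 (linked d t)) ts)
    ≡⟨ *-distribˡ-sum-map (𝟙 Q?) (𝟙 ∘ linked d) ts ⟨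
  𝟙 Q? * sum (map (𝟙 ∘ linked d) ts)
    ≡⟨ cong (𝟙 Q? *_) (length-filter≡sum-𝟙 (linked d) ts) ⟨
  𝟙 Q? * extensions n i d ∎
  where
  open ≡-Reasoning
  ts = listsOf (columns n) i
  linked = λ d t → linked? (step? n) (d ∷ t)

θ≡∑extensions : ∀ n k →
  θ n k ≡ ∑[ i < n ] ∑[ a < n ] ∑[ b < n ] 𝟙 (head? n k (a , b)) * extensions n i (a , b)
θ≡∑extensions n k = begin
  θ n k
    ≡⟨ length-filter≡sum-𝟙 (isPosNDIM₁₁? n k) (candidates n) ⟩
  sum (map count (concatMap (λ i → listsOf (columns n) (suc i)) (upTo n)))
    ≡⟨ sum-map-concatMap count _ (upTo n) ⟩
  sum (map (λ i → sum (map count (listsOf (columns n) (suc i)))) (upTo n))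
    ≡⟨ sum-map-upTo n _ ⟩
  ∑[ i < n ] sum (map count (listsOf (columns n) (suc i)))
    ≡⟨ ∑-cong n (λ i _ → sum-map-listsOf-columns n i count) ⟩
  ∑[ i < n ] ∑[ a < n ] ∑[ b < n ] sum (map (λ t → count ((a , b) ∷ t)) (listsOf (columns n) i))
    ≡⟨ ∑-cong n (λ i _ → ∑-cong n (λ a _ → ∑-cong n (λ b _ →
         sum-𝟙-factor n i (a , b) (isPosNDIM₁₁? n k) (head? n k (a , b)) (posNDIM₁₁⇔chain n k (a , b))))) ⟩
  ∑[ i < n ] ∑[ a < n ] ∑[ b < n ] 𝟙 (head? n k (a , b)) * extensions n i (a , b) ∎
  where
  open ≡-Reasoning
  count = 𝟙 ∘ isPosNDIM₁₁? n k

extensions-suc : ∀ n i c →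
  extensions n (suc i) c ≡ ∑[ a < n ] ∑[ b < n ] 𝟙 (step? n c (a , b)) * extensions n i (a , b)
extensions-suc n i c = begin
  extensions n (suc i) c
    ≡⟨ length-filter≡sum-𝟙 (linked? (step? n) ∘ (c ∷_)) (listsOf (columns n) (suc i)) ⟩
  sum (map (𝟙 ∘ linked? (step? n) ∘ (c ∷_)) (listsOf (columns n) (suc i)))
    ≡⟨ sum-map-listsOf-columns n i _ ⟩
  ∑[ a < n ] ∑[ b < n ] sum (map (λ t → 𝟙 (linked? (step? n) (c ∷ (a , b) ∷ t))) (listsOf (columns n) i))
    ≡⟨ ∑-cong n (λ a _ → ∑-cong n (λ b _ →
         sum-𝟙-factor n i (a , b) (linked? (step? n) ∘ (c ∷_)) (step? n c (a , b))
                      (λ _ → mk⇔ (λ { (s ∷ l) → s , l }) (uncurry _∷_)))) ⟩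
  ∑[ a < n ] ∑[ b < n ] 𝟙 (step? n c (a , b)) * extensions n i (a , b) ∎
  where open ≡-Reasoning

step-shift : ∀ n a b a' b' → Step (suc n) (suc a , suc b) (suc a' , suc b') ⇔ Step n (a , b) (a' , b')
step-shift n a b a' b' =
  mk⇔ (λ { ((s<s a<a' , s<s b<b') , s≤s b'≤a' , s<s a'<n) → (a<a' , b<b') , b'≤a' , a'<n })
      (λ ((a<a' , b<b') , b'≤a' , a'<n) → (s<s a<a' , s<s b<b') , s≤s b'≤a' , s<s a'<n)

extensions-shift : ∀ n i a b → extensions (suc n) i (suc a , suc b) ≡ extensions n i (a , b)
extensions-shift n zero    a b = refl
extensions-shift n (suc i) a b = begin
  extensions (suc n) (suc i) (suc a , suc b)
    ≡⟨ extensions-suc (suc n) i (suc a , suc b) ⟩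
  ∑[ a' < suc n ] ∑[ b' < suc n ] 𝟙 (step? (suc n) (suc a , suc b) (a' , b')) * extensions (suc n) i (a' , b')
    ≡⟨ ∑∑-shift n (λ d → 𝟙 (step? (suc n) (suc a , suc b) d) * extensions (suc n) i d)
                  (λ b' → 𝟙*-zero (step? (suc n) (suc a , suc b) (0 , b')) {extensions (suc n) i (0 , b')}
                                  λ { ((() , _) , _) })
                  (λ a' → 𝟙*-zero (step? (suc n) (suc a , suc b) (a' , 0)) {extensions (suc n) i (a' , 0)}
                                  λ { ((_ , ()) , _) }) ⟩
  ∑[ a' < n ] ∑[ b' < n ] 𝟙 (step? (suc n) (suc a , suc b) (suc a' , suc b')) * extensions (suc n) i (suc a' , suc b')
    ≡⟨ ∑-cong n (λ a' _ → ∑-cong n (λ b' _ →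
         cong₂ _*_ (𝟙-cong (step-shift n a b a' b') (step? (suc n) _ _) (step? n _ _))
                   (extensions-shift n i a' b'))) ⟩
  ∑[ a' < n ] ∑[ b' < n ] 𝟙 (step? n (a , b) (a' , b')) * extensions n i (a' , b')
    ≡⟨ extensions-suc n i (a , b) ⟨
  extensions n (suc i) (a , b) ∎
  where open ≡-Reasoning

extensions-suc≡0 : ∀ n i c → (∀ {d} → Step n c d → extensions n i d ≡ 0) → extensions n (suc i) c ≡ 0
extensions-suc≡0 n i c none = trans (extensions-suc n i c)
  (∑-zero n (λ a _ → ∑-zero n (λ b _ → 𝟙*-zero (step? n c (a , b)) none)))

extensions-long≡0 : ∀ n i a b → n ≤ a + suc i → extensions n (suc i) (a , b) ≡ 0
extensions-long≡0 n zero    a b n≤a+1 = extensions-suc≡0 n 0 (a , b) λ ((a<a' , _) , _ , a'<n) →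
  contradiction (≤-trans n≤a+1 (≤-trans (≤-reflexive (+-comm a 1)) a<a')) (<⇒≱ a'<n)
extensions-long≡0 n (suc i) a b n≤a+2+i = extensions-suc≡0 n (suc i) (a , b) λ { {a' , b'} ((a<a' , _) , _) →
  extensions-long≡0 n i a' b'
    (≤-trans n≤a+2+i (≤-trans (≤-reflexive (+-suc a (suc i))) (+-monoˡ-≤ (suc i) a<a'))) }

chainsFrom : ℕ → Column → ℕ
chainsFrom n c = ∑[ i < n ] extensions n i c

chainsFrom-shift : ∀ n a b → chainsFrom (suc (suc n)) (suc a , suc b) ≡ chainsFrom (suc n) (a , b)
chainsFrom-shift n a b = begin
  chainsFrom (suc (suc n)) (suc a , suc b)
    ≡⟨ ∑-last (suc n) _ ⟩
  (∑[ i < suc n ] extensions (suc (suc n)) i (suc a , suc b)) + extensions (suc (suc n)) (suc n) (suc a , suc b)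
    ≡⟨ cong₂ _+_ (∑-cong (suc n) (λ i _ → extensions-shift (suc n) i a b))
                 (extensions-long≡0 (suc (suc n)) n (suc a) (suc b) (s≤s (m≤n+m (suc n) a))) ⟩
  chainsFrom (suc n) (a , b) + 0
    ≡⟨ +-identityʳ _ ⟩
  chainsFrom (suc n) (a , b) ∎
  where open ≡-Reasoning

chainsFrom-unfold : ∀ n c → let N = suc (suc n) in
  chainsFrom N c ≡ 1 + (∑[ a < N ] ∑[ b < N ] 𝟙 (step? N c (a , b)) * chainsFrom N (a , b))
chainsFrom-unfold n c = trans (∑-suc (suc n) _) $ cong suc $ begin
  ∑[ i < suc n ] extensions N (suc i) c
    ≡⟨ ∑-cong (suc n) (λ i _ → extensions-suc N i c) ⟩
  ∑[ i < suc n ] ∑[ a < N ] ∑[ b < N ] 𝟙 (step? N c (a , b)) * extensions N i (a , b)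
    ≡⟨ ∑-swap (suc n) N (λ i a → ∑[ b < N ] 𝟙 (step? N c (a , b)) * extensions N i (a , b)) ⟩
  ∑[ a < N ] ∑[ i < suc n ] ∑[ b < N ] 𝟙 (step? N c (a , b)) * extensions N i (a , b)
    ≡⟨ ∑-cong N (λ a _ → ∑-swap (suc n) N (λ i b → 𝟙 (step? N c (a , b)) * extensions N i (a , b))) ⟩
  ∑[ a < N ] ∑[ b < N ] ∑[ i < suc n ] 𝟙 (step? N c (a , b)) * extensions N i (a , b)
    ≡⟨ ∑-cong N (λ a _ → ∑-cong N (λ b _ →
         *-distribˡ-∑ (suc n) (𝟙 (step? N c (a , b))) (λ i → extensions N i (a , b)))) ⟨
  ∑[ a < N ] ∑[ b < N ] 𝟙 (step? N c (a , b)) * (∑[ i < suc n ] extensions N i (a , b))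
    ≡⟨ ∑-cong N (λ a _ → ∑-cong N (λ b _ → 𝟙*-cong (step? N c (a , b)) λ ((c<a , _) , _) →
         all-but-longest (≤-trans (s≤s z≤n) c<a))) ⟩
  ∑[ a < N ] ∑[ b < N ] 𝟙 (step? N c (a , b)) * chainsFrom N (a , b) ∎
  where
  open ≡-Reasoning
  N = suc (suc n)
  all-but-longest : ∀ {a b} → 0 < a → ∑[ i < suc n ] extensions N i (a , b) ≡ chainsFrom N (a , b)
  all-but-longest {a} {b} a>0 = begin
    ∑[ i < suc n ] extensions N i (a , b)
      ≡⟨ +-identityʳ _ ⟨
    (∑[ i < suc n ] extensions N i (a , b)) + 0
      ≡⟨ cong (∑ (suc n) (λ i → extensions N i (a , b)) +_) (extensions-long≡0 N n a b (+-monoˡ-≤ (suc n) a>0)) ⟨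
    (∑[ i < suc n ] extensions N i (a , b)) + extensions N (suc n) (a , b)
      ≡⟨ ∑-last (suc n) _ ⟨
    chainsFrom N (a , b) ∎

θ≡∑chainsFrom : ∀ n k → k < n → θ n k ≡ ∑[ b < k ] chainsFrom n (k , suc b)
θ≡∑chainsFrom n@(suc n-1) k k<n@(s≤s k≤n-1) = begin
  θ n k
    ≡⟨ θ≡∑extensions n k ⟩
  ∑[ i < n ] ∑[ a < n ] ∑[ b < n ] 𝟙 (head? n k (a , b)) * extensions n i (a , b)
    ≡⟨ ∑-cong n (λ i _ → ∑-pick n k _ k<n (λ a a≢k → ∑-zero n (λ b _ →
         𝟙*-zero (head? n k (a , b)) (λ (a≡k , _) → contradiction a≡k a≢k)))) ⟩
  ∑[ i < n ] ∑[ b < n ] 𝟙 (head? n k (k , b)) * extensions n i (k , b)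
    ≡⟨ ∑-swap n n (λ i b → 𝟙 (head? n k (k , b)) * extensions n i (k , b)) ⟩
  ∑[ b < n ] ∑[ i < n ] 𝟙 (head? n k (k , b)) * extensions n i (k , b)
    ≡⟨ ∑-cong n (λ b _ → *-distribˡ-∑ n (𝟙 (head? n k (k , b))) (λ i → extensions n i (k , b))) ⟨
  ∑[ b < n ] 𝟙 (head? n k (k , b)) * chainsFrom n (k , b)
    ≡⟨ ∑-drop n 1 _ (λ { zero _ → 𝟙*-zero (head? n k (k , 0)) λ { (_ , () , _) } ; (suc _) (s≤s ()) }) ⟩
  ∑[ b < n-1 ] 𝟙 (head? n k (k , suc b)) * chainsFrom n (k , suc b)
    ≡⟨ ∑-truncate n-1 k _ k≤n-1 (λ b k≤b →
         𝟙*-zero (head? n k (k , suc b)) λ (_ , _ , b<k , _) → contradiction k≤b (<⇒≱ b<k)) ⟩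
  ∑[ b < k ] 𝟙 (head? n k (k , suc b)) * chainsFrom n (k , suc b)
    ≡⟨ ∑-cong k (λ b b<k → trans (cong (_* chainsFrom n (k , suc b)) (𝟙-yes (head? n k (k , suc b)) (refl , z<s , b<k , k<n)))
                                  (*-identityˡ _)) ⟩
  ∑[ b < k ] chainsFrom n (k , suc b) ∎
  where open ≡-Reasoning

θ-suc : ∀ m k → k < suc m → θ (suc (suc m)) (suc k) ≡ chainsFrom (suc (suc m)) (suc k , 1) + θ (suc m) k
θ-suc m k k<m+1 = begin
  θ (suc (suc m)) (suc k)
    ≡⟨ θ≡∑chainsFrom (suc (suc m)) (suc k) (s<s k<m+1) ⟩
  ∑[ b < suc k ] chainsFrom (suc (suc m)) (suc k , suc b)
    ≡⟨ ∑-suc k _ ⟩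
  chainsFrom (suc (suc m)) (suc k , 1) + (∑[ b < k ] chainsFrom (suc (suc m)) (suc k , suc (suc b)))
    ≡⟨ cong (chainsFrom (suc (suc m)) (suc k , 1) +_) (∑-cong k (λ b _ → chainsFrom-shift m k (suc b))) ⟩
  chainsFrom (suc (suc m)) (suc k , 1) + (∑[ b < k ] chainsFrom (suc m) (k , suc b))
    ≡⟨ cong (chainsFrom (suc (suc m)) (suc k , 1) +_) (θ≡∑chainsFrom (suc m) k k<m+1) ⟨
  chainsFrom (suc (suc m)) (suc k , 1) + θ (suc m) k ∎
  where open ≡-Reasoning

chainsFrom-row2≡1 : ∀ m k → k ≤ m →
  chainsFrom (suc (suc m)) (suc k , 1) ≡ 1 + (∑[ i < m ∸ k ] θ (suc m) (suc k + i))
chainsFrom-row2≡1 m k k≤m = begin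
  chainsFrom N (suc k , 1)
    ≡⟨ chainsFrom-unfold m (suc k , 1) ⟩
  1 + (∑[ a < N ] ∑[ b < N ] 𝟙 (step? N (suc k , 1) (a , b)) * chainsFrom N (a , b))
    ≡⟨ cong (1 +_) (∑-drop N (suc (suc k)) _ (λ a a≤k+1 → ∑-zero N (λ b _ →
         𝟙*-zero (step? N (suc k , 1) (a , b)) λ ((k+1<a , _) , _) → contradiction (s≤s⁻¹ a≤k+1) (<⇒≱ k+1<a)))) ⟩
  1 + (∑[ i < m ∸ k ] ∑[ b < N ] 𝟙 (step? N (suc k , 1) (suc (suc k + i) , b)) * chainsFrom N (suc (suc k + i) , b))
    ≡⟨ cong (1 +_) (∑-cong (m ∸ k) (λ i i<m∸k → later-column (suc k + i) (s≤s (m≤m+n k i)) (bound i i<m∸k))) ⟩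
  1 + (∑[ i < m ∸ k ] θ (suc m) (suc k + i)) ∎
  where
  open ≡-Reasoning
  N = suc (suc m)
  bound : ∀ i → i < m ∸ k → suc k + i < suc m
  bound i i<m∸k = s≤s (≤-trans (≤-reflexive (cong suc (+-comm k i))) (m≤o∸n⇒m+n≤o (suc i) k≤m i<m∸k))
  later-column : ∀ a → k < a → a < suc m →
    ∑[ b < N ] 𝟙 (step? N (suc k , 1) (suc a , b)) * chainsFrom N (suc a , b) ≡ θ (suc m) a
  later-column a k<a (s≤s a≤m) = begin
    ∑[ b < N ] 𝟙 (step? N (suc k , 1) (suc a , b)) * chainsFrom N (suc a , b)
      ≡⟨ ∑-drop N 2 _ (λ b b<2 →
           𝟙*-zero (step? N (suc k , 1) (suc a , b)) λ ((_ , 1<b) , _) → contradiction (s≤s⁻¹ b<2) (<⇒≱ 1<b)) ⟩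
    ∑[ j < m ] 𝟙 (step? N (suc k , 1) (suc a , suc (suc j))) * chainsFrom N (suc a , suc (suc j))
      ≡⟨ ∑-truncate m a _ a≤m (λ j a≤j →
           𝟙*-zero (step? N (suc k , 1) (suc a , suc (suc j))) λ { (_ , s≤s j<a , _) → contradiction a≤j (<⇒≱ j<a) }) ⟩
    ∑[ j < a ] 𝟙 (step? N (suc k , 1) (suc a , suc (suc j))) * chainsFrom N (suc a , suc (suc j))
      ≡⟨ ∑-cong a (λ j j<a → trans (cong (_* chainsFrom N (suc a , suc (suc j))) (𝟙-yes (step? N (suc k , 1) (suc a , suc (suc j)))
                                      ((s<s k<a , s<s z<s) , s≤s j<a , s<s (s≤s a≤m))))
                                    (trans (*-identityˡ _) (chainsFrom-shift m a (suc j)))) ⟩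
    ∑[ j < a ] chainsFrom (suc m) (a , suc j)
      ≡⟨ θ≡∑chainsFrom (suc m) a (s≤s a≤m) ⟨
    θ (suc m) a ∎

corollary5p3 : (n k : ℕ) → 3 < n → 2 ≤ k → k ≤ n ∸ 2 →
    θ n k ≡ 1 + sumFromTo (k ∸ 1) (n ∸ 2) (θ (n ∸ 1))
corollary5p3 (suc (suc m)) (suc k) (s≤s (s≤s _)) (s≤s _) k<m = begin
  θ (suc (suc m)) (suc k)
    ≡⟨ θ-suc m k (m≤n⇒m≤1+n k<m) ⟩
  chainsFrom (suc (suc m)) (suc k , 1) + θ (suc m) k
    ≡⟨ cong (_+ θ (suc m) k) (chainsFrom-row2≡1 m k k≤m) ⟩
  1 + (∑[ i < m ∸ k ] θ (suc m) (suc k + i)) + θ (suc m) k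
    ≡⟨ cong suc (+-comm _ (θ (suc m) k)) ⟩
  1 + (θ (suc m) k + (∑[ i < m ∸ k ] θ (suc m) (suc k + i)))
    ≡⟨ cong suc (∑-from-suc m k (θ (suc m)) k≤m) ⟨
  1 + (∑[ i < suc m ∸ k ] θ (suc m) (k + i))
    ≡⟨ cong suc (sum-map-upTo (suc m ∸ k) _) ⟨
  1 + sumFromTo k m (θ (suc m)) ∎
  where
  open ≡-Reasoning
  k≤m = <⇒≤ k<m
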